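{- Let $p\ge 2$ and $n\ge 2$ be integers, let $E\in\mathbb{Z}[X]$ be a monic polynomial of degree $n$, and let $\gamma$ be an integer with $0<\gamma<p$ and $E(\gamma)\equiv 0\pmod p$. Let $\mathfrak{L}\subseteq\mathbb{Z}^n$ be the lattice generated by the rows $A_0=(p,0,\dots,0)$ and $A_i=-\gamma e_{i-1}+e_i$ for $1\le i\le n-1$ (where $e_0,\dots,e_{n-1}$ is the standard basis of $\mathbb{Z}^n$), and let $r$ be the covering radius of $\mathfrak{L}$ with respect to the Euclidean norm, i.e. the smallest $r\ge 0$ such that for every $T\in\mathbb{R}^n$ there is $V\in\mathfrak{L}$ with $\|T-V\|_2\le r$. If $\rho>r$, then $(p,n,\gamma,\rho)_E$ is a Polynomial Modular Number System.
   Context: A Polynomial Modular Number System (PMNS) $(p,n,\gamma,\rho)_E$ consists of integers $p,n,\gamma,\rho$ and a monic polynomial $E\in\mathbb{Z}[X]$ of degree $n$ such that $0<\gamma<p$, $E(\gamma)\equiv 0 \pmod p$, and for every integer $x\in\{0,\dots,p-1\}$ there exist integers $x_0,\dots,x_{n-1}$ with $-\rho<x_i<\rho$ for all $i$ and $x\equiv \sum_{i=0}^{n-1}x_i\gamma^i \pmod p$. Vectors $(v_0,\dots,v_{n-1})$ are identified with polynomials $\sum v_iX^i$; $\mathfrak{L}$ is the set of integer polynomials of degree $<n$ vanishing at $\gamma$ modulo $p$. -}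

module Defs where

open import Data.Nat using (ℕ; zero; suc)
open import Data.Fin using (Fin; zero; suc; inject₁; toℕ)
import Data.Fin as Fin
open import Data.Integer as ℤ using (ℤ; +_; -_)
open import Data.Integer.Divisibility using (_∣_)
import Data.Rational as ℚ
open import Data.Rational using (ℚ; _/_)
open import Data.Product using (Σ; ∃; _×_; _,_)
open import Relation.Nullary using (yes; no)

sumFin : {A : Set} → (A → A → A) → A → {n : ℕ} → (Fin n → A) → A
sumFin _⊕_ z {zero}  f = z
sumFin _⊕_ z {suc n} f = f zero ⊕ sumFin _⊕_ z (λ i → f (suc i))

Σℤ : {n : ℕ} → (Fin n → ℤ) → ℤ
Σℤ = sumFin ℤ._+_ (+ 0)

Σℚ : {n : ℕ} → (Fin n → ℚ) → ℚ
Σℚ = sumFin ℚ._+_ ℚ.0ℚ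

toℚ : ℤ → ℚ
toℚ z = z / 1

-- Monic polynomial of degree n: X^n + Σ_{i<n} e i X^i, given by its lower coefficients.
evalMonic : {n : ℕ} → (Fin n → ℤ) → ℤ → ℤ
evalMonic {n} e x = x ℤ.^ n ℤ.+ Σℤ (λ i → e i ℤ.* x ℤ.^ toℕ i)

evalVec : {n : ℕ} → (Fin n → ℤ) → ℤ → ℤ
evalVec v γ = Σℤ (λ i → v i ℤ.* γ ℤ.^ toℕ i)

record IsPMNS (p : ℤ) (n : ℕ) (γ ρ : ℤ) (e : Fin n → ℤ) : Set where
  field
    γ-pos     : + 0 ℤ.< γ
    γ<p       : γ ℤ.< p
    E[γ]≡0    : p ∣ evalMonic e γ
    represent : (x : ℤ) → + 0 ℤ.≤ x → x ℤ.< p →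
                Σ (Fin n → ℤ) λ xs →
                  ((i : Fin n) → (- ρ ℤ.< xs i) × (xs i ℤ.< ρ)) ×
                  (p ∣ (x ℤ.- evalVec xs γ))

-- Generator rows of 𝔏: A_0 = (p,0,…,0), A_i = -γ e_{i-1} + e_i (1 ≤ i ≤ n-1).
-- gen p γ i j is the j-th coordinate of A_i.
gen : {n : ℕ} → ℤ → ℤ → Fin n → Fin n → ℤ
gen {suc m} p γ zero j with j Fin.≟ zero
... | yes _ = p
... | no  _ = + 0
gen {suc m} p γ (suc i) j with j Fin.≟ suc i | j Fin.≟ inject₁ i
... | yes _ | _     = + 1
... | no  _ | yes _ = - γ
... | no  _ | no  _ = + 0

InLattice : {n : ℕ} → ℤ → ℤ → (Fin n → ℤ) → Set
InLattice {n} p γ V =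
  ∃ λ (c : Fin n → ℤ) → (j : Fin n) → V j ≡ Σℤ (λ i → c i ℤ.* gen p γ i j)
  where open import Relation.Binary.PropositionalEquality using (_≡_)

dist² : {n : ℕ} → (Fin n → ℚ) → (Fin n → ℤ) → ℚ
dist² T V = Σℚ (λ j → (T j ℚ.- toℚ (V j)) ℚ.* (T j ℚ.- toℚ (V j)))

-- Every point is within distance s of 𝔏 (closed balls), tested on rational points.
Covers : (n : ℕ) → ℤ → ℤ → ℚ → Set
Covers n p γ s = (T : Fin n → ℚ) → ∃ λ (V : Fin n → ℤ) → InLattice p γ V × (dist² T V ℚ.≤ s ℚ.* s)

-- "covering radius r of 𝔏 satisfies r < ρ"
CoveringRadius< : (n : ℕ) → ℤ → ℤ → ℤ → Set
CoveringRadius< n p γ ρ =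
  ∃ λ (s : ℚ) → (ℚ.0ℚ ℚ.≤ s) × (s ℚ.< toℚ ρ) × Covers n p γ s

{-# OPTIONS --safe #-}
-- Evaluation at γ, v ↦ Σ vᵢ γⁱ, is ℤ-linear; it sends the generator A₀ to p and every other
-- generator Aᵢ = eᵢ − γ eᵢ₋₁ to 0, so it maps the lattice 𝔏 into pℤ. Given x, cover the point
-- x e₀ by some V ∈ 𝔏 at distance ≤ s < ρ: every coordinate of x e₀ − V is then smaller than ρ
-- in absolute value, and x e₀ − V evaluates to x minus a multiple of p.
module Submission where

open import Defs
open import Algebra.Bundles using (CommutativeMonoid)
open import Data.Nat as ℕ using (ℕ; zero; suc; _≤_)
import Data.Nat.Properties as ℕP
open import Data.Fin as Fin using (Fin; zero; suc; toℕ; inject₁; punchIn)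
import Data.Fin.Properties as FinP
open import Data.Integer as ℤ using (ℤ; +_; -[1+_]; _+_; _*_; -_; _-_; _^_; +≤+; +<+; -<+; -<-)
import Data.Integer.Properties as ℤP
open import Data.Integer.Divisibility using (_∣_)
import Data.Integer.Divisibility.Signed as ℤ∣
open import Data.Integer.Tactic.RingSolver using (solve-∀)
open import Data.Rational as ℚ using (mkℚ)
import Data.Rational.Properties as ℚP
open import Data.Nat.Coprimality using (1-coprimeTo) renaming (sym to coprime-sym)
open import Data.Vec.Functional using (Vector; removeAt)
open import Data.Product using (Σ; ∃; _×_; _,_)
open import Function using (_∘_)
open import Relation.Binary.PropositionalEquality using (_≡_; _≢_; _≗_; refl; sym; trans; cong; cong₂; subst; subst₂; module ≡-Reasoning)
open import Relation.Nullary using (does; yes; no)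
open import Data.Bool using (if_then_else_)
open import Data.Empty using (⊥-elim)

module _ {a ℓ} (M : CommutativeMonoid a ℓ) where
  open CommutativeMonoid M renaming (_∙_ to _⊕_; ε to 0#; identityʳ to ⊕-identityʳ; ∙-congˡ to ⊕-congˡ)
  open import Algebra.Properties.CommutativeMonoid.Sum M using (sum; sum-remove; sum-cong-≋; sum-replicate-zero)
  open import Relation.Binary.Reasoning.Setoid setoid

  sum-supported : ∀ {n} (t : Vector Carrier (suc n)) k → (∀ j → j ≢ k → t j ≈ 0#) → sum t ≈ t k
  sum-supported {n} t k vanishes = begin
    sum t                     ≈⟨ sum-remove {i = k} t ⟩
    t k ⊕ sum (removeAt t k)  ≈⟨ ⊕-congˡ (sum-cong-≋ (λ j → vanishes (punchIn k j) (FinP.punchInᵢ≢i k j))) ⟩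
    t k ⊕ sum {n} (λ _ → 0#)  ≈⟨ ⊕-congˡ (sum-replicate-zero n) ⟩
    t k ⊕ 0#                  ≈⟨ ⊕-identityʳ (t k) ⟩
    t k                       ∎

open import Algebra.Properties.Semiring.Sum ℤP.+-*-semiring
  using (sum; sum-cong-≗; sum-remove; sum-replicate-zero; ∑-comm; ∑-distrib-+; *-distribˡ-sum; *-distribʳ-sum)

Σℤ≡sum : ∀ {n} (f : Vector ℤ n) → Σℤ f ≡ sum f
Σℤ≡sum {zero}  f = refl
Σℤ≡sum {suc n} f = cong (_+_ (f zero)) (Σℤ≡sum (f ∘ suc))

sum-nonneg : ∀ {n} (f : Vector ℤ n) → (∀ j → + 0 ℤ.≤ f j) → + 0 ℤ.≤ sum f
sum-nonneg {zero}  f f≥0 = +≤+ ℕ.z≤n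
sum-nonneg {suc n} f f≥0 = ℤP.+-mono-≤ (f≥0 zero) (sum-nonneg (f ∘ suc) (f≥0 ∘ suc))

nonneg⇒≤sum : ∀ {n} (f : Vector ℤ n) → (∀ j → + 0 ℤ.≤ f j) → ∀ k → f k ℤ.≤ sum f
nonneg⇒≤sum {suc n} f f≥0 k = begin
  f k                           ≡⟨ ℤP.+-identityʳ (f k) ⟨
  f k + + 0                     ≤⟨ ℤP.+-monoʳ-≤ (f k) (sum-nonneg (removeAt f k) (f≥0 ∘ punchIn k)) ⟩
  f k + sum (removeAt f k)      ≡⟨ sum-remove {i = k} f ⟨
  sum f                         ∎
  where open ℤP.≤-Reasoning

module _ (γ : ℤ) where
  open ≡-Reasoning

  evalVec≡sum : ∀ {n} (v : Vector ℤ n) → evalVec v γ ≡ sum (λ j → v j * γ ^ toℕ j)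
  evalVec≡sum v = Σℤ≡sum (λ j → v j * γ ^ toℕ j)

  evalVec-cong : ∀ {n} {u v : Vector ℤ n} → u ≗ v → evalVec u γ ≡ evalVec v γ
  evalVec-cong {u = u} {v} u≗v = begin
    evalVec u γ                     ≡⟨ evalVec≡sum u ⟩
    sum (λ j → u j * γ ^ toℕ j)     ≡⟨ sum-cong-≗ (λ j → cong (_* γ ^ toℕ j) (u≗v j)) ⟩
    sum (λ j → v j * γ ^ toℕ j)     ≡⟨ evalVec≡sum v ⟨
    evalVec v γ                     ∎

  evalVec-+ : ∀ {n} (u v : Vector ℤ n) → evalVec (λ j → u j + v j) γ ≡ evalVec u γ + evalVec v γ
  evalVec-+ u v = begin
    evalVec (λ j → u j + v j) γ                                    ≡⟨ evalVec≡sum (λ j → u j + v j) ⟩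
    sum (λ j → (u j + v j) * γ ^ toℕ j)                            ≡⟨ sum-cong-≗ (λ j → ℤP.*-distribʳ-+ (γ ^ toℕ j) (u j) (v j)) ⟩
    sum (λ j → u j * γ ^ toℕ j + v j * γ ^ toℕ j)                  ≡⟨ ∑-distrib-+ (λ j → u j * γ ^ toℕ j) (λ j → v j * γ ^ toℕ j) ⟩
    sum (λ j → u j * γ ^ toℕ j) + sum (λ j → v j * γ ^ toℕ j)      ≡⟨ cong₂ _+_ (evalVec≡sum u) (evalVec≡sum v) ⟨
    evalVec u γ + evalVec v γ                                      ∎

  evalVec-*ˡ : ∀ {n} a (v : Vector ℤ n) → evalVec (λ j → a * v j) γ ≡ a * evalVec v γ
  evalVec-*ˡ a v = begin
    evalVec (λ j → a * v j) γ               ≡⟨ evalVec≡sum (λ j → a * v j) ⟩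
    sum (λ j → a * v j * γ ^ toℕ j)         ≡⟨ sum-cong-≗ (λ j → ℤP.*-assoc a (v j) (γ ^ toℕ j)) ⟩
    sum (λ j → a * (v j * γ ^ toℕ j))       ≡⟨ *-distribˡ-sum a (λ j → v j * γ ^ toℕ j) ⟨
    a * sum (λ j → v j * γ ^ toℕ j)         ≡⟨ cong (a *_) (evalVec≡sum v) ⟨
    a * evalVec v γ                         ∎

  evalVec-neg : ∀ {n} (v : Vector ℤ n) → evalVec (λ j → - v j) γ ≡ - evalVec v γ
  evalVec-neg v = begin
    evalVec (λ j → - v j) γ          ≡⟨ evalVec-cong (λ j → ℤP.-1*i≡-i (v j)) ⟨
    evalVec (λ j → ℤ.-1ℤ * v j) γ    ≡⟨ evalVec-*ˡ ℤ.-1ℤ v ⟩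
    ℤ.-1ℤ * evalVec v γ              ≡⟨ ℤP.-1*i≡-i (evalVec v γ) ⟩
    - evalVec v γ                    ∎

  evalVec-minus : ∀ {n} (u v : Vector ℤ n) → evalVec (λ j → u j - v j) γ ≡ evalVec u γ - evalVec v γ
  evalVec-minus u v = trans (evalVec-+ u (λ j → - v j)) (cong (_+_ (evalVec u γ)) (evalVec-neg v))

  evalVec-sum : ∀ {m n} (w : Fin m → Vector ℤ n) →
                evalVec (λ j → sum (λ i → w i j)) γ ≡ sum (λ i → evalVec (w i) γ)
  evalVec-sum w = begin
    evalVec (λ j → sum (λ i → w i j)) γ                    ≡⟨ evalVec≡sum (λ j → sum (λ i → w i j)) ⟩
    sum (λ j → sum (λ i → w i j) * γ ^ toℕ j)              ≡⟨ sum-cong-≗ (λ j → *-distribʳ-sum (γ ^ toℕ j) (λ i → w i j)) ⟩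
    sum (λ j → sum (λ i → w i j * γ ^ toℕ j))              ≡⟨ ∑-comm (λ i j → w i j * γ ^ toℕ j) ⟨
    sum (λ i → sum (λ j → w i j * γ ^ toℕ j))              ≡⟨ sum-cong-≗ (λ i → evalVec≡sum (w i)) ⟨
    sum (λ i → evalVec (w i) γ)                            ∎

basis : ∀ {n} → Fin n → Vector ℤ n
basis k j = if does (j Fin.≟ k) then + 1 else + 0

basis-vanishes : ∀ {n} {k j : Fin n} → j ≢ k → basis k j ≡ + 0
basis-vanishes {k = k} {j} j≢k with j Fin.≟ k
... | yes j≡k = ⊥-elim (j≢k j≡k)
... | no  _   = refl

basis-self : ∀ {n} (k : Fin n) → basis k k ≡ + 1
basis-self k with k Fin.≟ k
... | yes _   = refl
... | no  k≢k = ⊥-elim (k≢k refl)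

evalVec-basis : ∀ {n} γ (k : Fin n) → evalVec (basis k) γ ≡ γ ^ toℕ k
evalVec-basis {suc n} γ k = begin
  evalVec (basis k) γ                ≡⟨ evalVec≡sum γ (basis k) ⟩
  sum (λ j → basis k j * γ ^ toℕ j)  ≡⟨ sum-supported ℤP.+-0-commutativeMonoid _ k
                                          (λ j j≢k → cong (_* γ ^ toℕ j) (basis-vanishes j≢k)) ⟩
  basis k k * γ ^ toℕ k              ≡⟨ cong (_* γ ^ toℕ k) (basis-self k) ⟩
  + 1 * γ ^ toℕ k                    ≡⟨ ℤP.*-identityˡ (γ ^ toℕ k) ⟩
  γ ^ toℕ k                          ∎
  where open ≡-Reasoning

evalVec-scaled-basis-zero : ∀ {m} γ a → evalVec (λ (j : Fin (suc m)) → a * basis zero j) γ ≡ a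
evalVec-scaled-basis-zero {m} γ a = begin
  evalVec (λ j → a * e₀ j) γ           ≡⟨ evalVec-*ˡ γ a e₀ ⟩
  a * evalVec e₀ γ                     ≡⟨ cong (a *_) (evalVec-basis γ (zero {m})) ⟩
  a * + 1                              ≡⟨ ℤP.*-identityʳ a ⟩
  a                                    ∎
  where
  open ≡-Reasoning
  e₀ : Vector ℤ (suc m)
  e₀ = basis zero

suc≢inject₁ : ∀ {n} (i : Fin n) → suc i ≢ inject₁ i
suc≢inject₁ i eq = ℕP.1+n≢n (trans (cong toℕ eq) (FinP.toℕ-inject₁ i))

module _ {m : ℕ} (p γ : ℤ) where
  open ≡-Reasoning

  A : Fin (suc m) → Vector ℤ (suc m)
  A = gen p γ

  A-zero : A zero ≗ (λ j → p * basis zero j)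
  A-zero j with j Fin.≟ zero
  ... | yes _ = sym (ℤP.*-identityʳ p)
  ... | no  _ = sym (ℤP.*-zeroʳ p)

  A-suc : ∀ i → A (suc i) ≗ (λ j → basis (suc i) j + - γ * basis (inject₁ i) j)
  A-suc i j with j Fin.≟ suc i | j Fin.≟ inject₁ i
  ... | yes refl | yes eq = ⊥-elim (suc≢inject₁ i eq)
  ... | yes _    | no  _  = sym (cong (_+_ (+ 1)) (ℤP.*-zeroʳ (- γ)))
  ... | no  _    | yes _  = sym (trans (ℤP.+-identityˡ _) (ℤP.*-identityʳ (- γ)))
  ... | no  _    | no  _  = sym (trans (ℤP.+-identityˡ _) (ℤP.*-zeroʳ (- γ)))

  evalVec-A-zero : evalVec (A zero) γ ≡ p
  evalVec-A-zero = trans (evalVec-cong γ A-zero) (evalVec-scaled-basis-zero {m} γ p)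

  evalVec-A-suc : ∀ i → evalVec (A (suc i)) γ ≡ + 0
  evalVec-A-suc i = begin
    evalVec (A (suc i)) γ                                              ≡⟨ evalVec-cong γ (A-suc i) ⟩
    evalVec (λ j → basis (suc i) j + - γ * basis (inject₁ i) j) γ      ≡⟨ evalVec-+ γ (basis (suc i)) (λ j → - γ * basis (inject₁ i) j) ⟩
    evalVec (basis (suc i)) γ + evalVec (λ j → - γ * basis (inject₁ i) j) γ
                                                                       ≡⟨ cong (_+_ (evalVec (basis (suc i)) γ)) (evalVec-*ˡ γ (- γ) (basis (inject₁ i))) ⟩
    evalVec (basis (suc i)) γ + - γ * evalVec (basis (inject₁ i)) γ    ≡⟨ cong₂ (λ a b → a + - γ * b) (evalVec-basis γ (suc i)) (evalVec-basis γ (inject₁ i)) ⟩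
    γ * γ ^ toℕ i + - γ * γ ^ toℕ (inject₁ i)                          ≡⟨ cong (λ k → γ * γ ^ toℕ i + - γ * γ ^ k) (FinP.toℕ-inject₁ i) ⟩
    γ * γ ^ toℕ i + - γ * γ ^ toℕ i                                    ≡⟨ cancel γ (γ ^ toℕ i) ⟩
    + 0                                                                ∎
    where
    cancel : ∀ a b → a * b + - a * b ≡ + 0
    cancel = solve-∀

  evalVec-lattice : ∀ V → InLattice p γ V → p ∣ evalVec V γ
  evalVec-lattice V (c , V≡) = ℤ∣.∣⇒∣ᵤ (ℤ∣.divides (c zero) (begin
    evalVec V γ                                                         ≡⟨ evalVec-cong γ (λ j → trans (V≡ j) (Σℤ≡sum (λ i → c i * A i j))) ⟩
    evalVec (λ j → sum (λ i → c i * A i j)) γ                           ≡⟨ evalVec-sum γ (λ i j → c i * A i j) ⟩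
    sum (λ i → evalVec (λ j → c i * A i j) γ)                           ≡⟨ sum-cong-≗ (λ i → evalVec-*ˡ γ (c i) (A i)) ⟩
    c zero * evalVec (A zero) γ + sum (λ i → c (suc i) * evalVec (A (suc i)) γ)
                                                                        ≡⟨ cong₂ _+_ (cong (c zero *_) evalVec-A-zero) higher-rows≡0 ⟩
    c zero * p + + 0                                                    ≡⟨ ℤP.+-identityʳ (c zero * p) ⟩
    c zero * p                                                          ∎))
    where
    higher-rows≡0 : sum (λ i → c (suc i) * evalVec (A (suc i)) γ) ≡ + 0
    higher-rows≡0 = begin
      sum (λ i → c (suc i) * evalVec (A (suc i)) γ)  ≡⟨ sum-cong-≗ (λ i → trans (cong (c (suc i) *_) (evalVec-A-suc i)) (ℤP.*-zeroʳ (c (suc i)))) ⟩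
      sum {m} (λ _ → + 0)                            ≡⟨ sum-replicate-zero m ⟩
      + 0                                            ∎

toℚ≡mkℚ : ∀ z → toℚ z ≡ mkℚ z 0 (coprime-sym (1-coprimeTo ℤ.∣ z ∣))
toℚ≡mkℚ z = ℚP.↥p/↧p≡p (mkℚ z 0 (coprime-sym (1-coprimeTo ℤ.∣ z ∣)))

toℚ-homo-+ : ∀ a b → toℚ (a + b) ≡ toℚ a ℚ.+ toℚ b
toℚ-homo-+ a b rewrite toℚ≡mkℚ a | toℚ≡mkℚ b =
  cong (ℚ._/ 1) (sym (cong₂ _+_ (ℤP.*-identityʳ a) (ℤP.*-identityʳ b)))

toℚ-homo-* : ∀ a b → toℚ (a * b) ≡ toℚ a ℚ.* toℚ b
toℚ-homo-* a b rewrite toℚ≡mkℚ a | toℚ≡mkℚ b = refl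

toℚ-homo‿- : ∀ a → toℚ (- a) ≡ ℚ.- toℚ a
toℚ-homo‿- a rewrite toℚ≡mkℚ a | toℚ≡mkℚ (- a) with a
... | + zero   = refl
... | + suc _  = refl
... | -[1+ _ ] = refl

toℚ-homo-minus : ∀ a b → toℚ (a - b) ≡ toℚ a ℚ.- toℚ b
toℚ-homo-minus a b = trans (toℚ-homo-+ a (- b)) (cong (toℚ a ℚ.+_) (toℚ-homo‿- b))

toℚ-cancel-< : ∀ {a b} → toℚ a ℚ.< toℚ b → a ℤ.< b
toℚ-cancel-< {a} {b} a<b rewrite toℚ≡mkℚ a | toℚ≡mkℚ b with a<b
... | ℚ.*<* a*1<b*1 = subst₂ ℤ._<_ (ℤP.*-identityʳ a) (ℤP.*-identityʳ b) a*1<b*1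

dist²-toℚ : ∀ {n} (t V : Vector ℤ n) → dist² (toℚ ∘ t) V ≡ toℚ (sum (λ j → (t j - V j) * (t j - V j)))
dist²-toℚ {zero}  t V = refl
dist²-toℚ {suc n} t V = begin
  dist² (toℚ ∘ t) V                                       ≡⟨ cong₂ ℚ._+_ (sym square₀) (dist²-toℚ (t ∘ suc) (V ∘ suc)) ⟩
  toℚ (d zero * d zero) ℚ.+ toℚ (sum (λ j → d (suc j) * d (suc j)))
                                                          ≡⟨ toℚ-homo-+ (d zero * d zero) _ ⟨
  toℚ (sum (λ j → d j * d j))                             ∎
  where
  open ≡-Reasoning
  d : Vector ℤ (suc n)
  d j = t j - V j
  square₀ : toℚ (d zero * d zero) ≡ (toℚ (t zero) ℚ.- toℚ (V zero)) ℚ.* (toℚ (t zero) ℚ.- toℚ (V zero))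
  square₀ = trans (toℚ-homo-* (d zero) (d zero)) (cong₂ ℚ._*_ (toℚ-homo-minus (t zero) (V zero)) (toℚ-homo-minus (t zero) (V zero)))

square-mono-<-nonNeg : ∀ {p q} → ℚ.0ℚ ℚ.≤ p → p ℚ.< q → p ℚ.* p ℚ.< q ℚ.* q
square-mono-<-nonNeg {p} {q} 0≤p p<q = ℚP.≤-<-trans
  (ℚP.*-monoʳ-≤-nonNeg p {{ℚ.nonNegative 0≤p}} (ℚP.<⇒≤ p<q))
  (ℚP.*-monoʳ-<-pos q {{ℚ.positive (ℚP.≤-<-trans 0≤p p<q)}} p<q)

square-cancel-< : ∀ {m n} → m ℕ.* m ℕ.< n ℕ.* n → m ℕ.< n
square-cancel-< m²<n² = ℕP.≰⇒> (λ n≤m → ℕP.<⇒≱ m²<n² (ℕP.*-mono-≤ n≤m n≤m))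

square-nonneg : ∀ y → + 0 ℤ.≤ y * y
square-nonneg (+ a)    = subst (+ 0 ℤ.≤_) (ℤP.pos-* a a) (+≤+ ℕ.z≤n)
square-nonneg -[1+ a ] = +≤+ ℕ.z≤n

square<square⇒bounded : ∀ {ρ} y → + 0 ℤ.< ρ → y * y ℤ.< ρ * ρ → - ρ ℤ.< y × y ℤ.< ρ
square<square⇒bounded {+ zero}  _        (+<+ ())
square<square⇒bounded {+ suc r} (+ a)    _ y²<ρ² =
  -<+ , +<+ (square-cancel-< (ℤP.drop‿+<+ (subst (ℤ._< ρ * ρ) (sym (ℤP.pos-* a a)) y²<ρ²)))
  where ρ = + suc r
square<square⇒bounded {+ suc r} -[1+ a ] _ y²<ρ² =
  -<- (ℕ.s<s⁻¹ (square-cancel-< (ℤP.drop‿+<+ y²<ρ²))) , -<+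

close⇒coordinates-bounded :
  ∀ {n} ρ s (t V : Vector ℤ n) → ℚ.0ℚ ℚ.≤ s → s ℚ.< toℚ ρ → dist² (toℚ ∘ t) V ℚ.≤ s ℚ.* s →
  ∀ i → (- ρ ℤ.< t i - V i) × (t i - V i ℤ.< ρ)
close⇒coordinates-bounded ρ s t V 0≤s s<ρ close i =
  square<square⇒bounded (d i) (toℚ-cancel-< (ℚP.≤-<-trans 0≤s s<ρ))
    (ℤP.≤-<-trans (nonneg⇒≤sum (λ j → d j * d j) (λ j → square-nonneg (d j)) i) ‖d‖²<ρ²)
  where
  d = λ j → t j - V j
  ‖d‖²<ρ² : sum (λ j → d j * d j) ℤ.< ρ * ρ
  ‖d‖²<ρ² = toℚ-cancel-< (begin-strict
    toℚ (sum (λ j → d j * d j))  ≡⟨ dist²-toℚ t V ⟨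
    dist² (toℚ ∘ t) V            ≤⟨ close ⟩
    s ℚ.* s                      <⟨ square-mono-<-nonNeg 0≤s s<ρ ⟩
    toℚ ρ ℚ.* toℚ ρ              ≡⟨ toℚ-homo-* ρ ρ ⟨
    toℚ (ρ * ρ)                  ∎)
    where open ℚP.≤-Reasoning

covering⇒representation :
  ∀ {m} p γ ρ s → ℚ.0ℚ ℚ.≤ s → s ℚ.< toℚ ρ → Covers (suc m) p γ s → (x : ℤ) →
  Σ (Vector ℤ (suc m)) λ xs → (∀ i → (- ρ ℤ.< xs i) × (xs i ℤ.< ρ)) × (p ∣ (x - evalVec xs γ))
covering⇒representation {m} p γ ρ s 0≤s s<ρ covers x = represent (covers (toℚ ∘ t))
  where
  t : Vector ℤ (suc m)
  t j = x * basis zero j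

  represent : ∃ (λ V → InLattice p γ V × dist² (toℚ ∘ t) V ℚ.≤ s ℚ.* s) →
              Σ (Vector ℤ (suc m)) λ xs → (∀ i → (- ρ ℤ.< xs i) × (xs i ℤ.< ρ)) × (p ∣ (x - evalVec xs γ))
  represent (V , V∈𝔏 , close) =
    (λ j → t j - V j) ,
    close⇒coordinates-bounded ρ s t V 0≤s s<ρ close ,
    subst (p ∣_) (sym x-evalVec≡evalVec-V) (evalVec-lattice p γ V V∈𝔏)
    where
    open ≡-Reasoning
    x-evalVec≡evalVec-V : x - evalVec (λ j → t j - V j) γ ≡ evalVec V γ
    x-evalVec≡evalVec-V = begin
      x - evalVec (λ j → t j - V j) γ      ≡⟨ cong (_-_ x) (evalVec-minus γ t V) ⟩
      x - (evalVec t γ - evalVec V γ)      ≡⟨ cong (λ a → x - (a - evalVec V γ)) (evalVec-scaled-basis-zero {m} γ x) ⟩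
      x - (x - evalVec V γ)                ≡⟨ a-[a-b]≡b x (evalVec V γ) ⟩
      evalVec V γ                          ∎
      where
      a-[a-b]≡b : ∀ a b → a - (a - b) ≡ b
      a-[a-b]≡b = solve-∀

theorem1 : (p : ℤ) (n : ℕ) (γ ρ : ℤ) (e : Fin n → ℤ) →
           + 2 ℤ.≤ p → 2 ≤ n →
           + 0 ℤ.< γ → γ ℤ.< p → p ∣ evalMonic e γ →
           CoveringRadius< n p γ ρ →
           IsPMNS p n γ ρ e
-- Every integer x is represented.
theorem1 p (suc m) γ ρ e _ _ 0<γ γ<p p∣E[γ] (s , 0≤s , s<ρ , covers) = record
  { γ-pos     = 0<γ
  ; γ<p       = γ<p
  ; E[γ]≡0    = p∣E[γ]
  ; represent = λ x _ _ → covering⇒representation p γ ρ s 0≤s s<ρ covers x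
  }
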